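{- Let $\mathbf{h}$ be a weakly increasing sequence of positive integers with $\mathbf{h}(i)>i$ for all $i$, let $S$ be a nonempty $\mathbf{h}$-admissible set and $m=\mathbf{m}(S)$. Then $$b_k(S)=h_{k-1}(P_{\mathbf{h},S},\mathbf{h}(m))\quad\text{for all }\ \mathbf{h}(m)-m\le k\le\mathbf{h}(m).$$
   Context: $\mathcal{P}_\mathbf{h}=\{(i,j): i<j\le \mathbf{h}(i)\}$. For $\pi\in S_n$, $\mathrm{inv}_\mathbf{h}(\pi)=\{(i,j)\in\mathcal{P}_\mathbf{h}: j\le n,\ \pi_i>\pi_j\}$. $S$ is $\mathbf{h}$-admissible if $S=\mathrm{inv}_\mathbf{h}(\pi)$ for some permutation $\pi$. $I_\mathbf{h}(S,n)=\{\pi\in S_n:\mathrm{inv}_\mathbf{h}(\pi)=S\}$. $\mathbf{m}(S)=\max\{i:(i,i+1)\in S\}$. $b_k(S)=\#\{\pi\in I_\mathbf{h}(S,\mathbf{h}(m)):\pi_{\mathbf{h}(m)}=k\}$. $P_{\mathbf{h},S}$ is the poset on $[\mathbf{h}(m)]$ whose order $<_S$ is generated by the relations $i>_S j$ whenever $(i,j)\in S$, and $i<_S j$ whenever $(i,j)\in\mathcal{P}_\mathbf{h}\setminus S$ with $j\le\mathbf{h}(m)$. For a finite poset $P$ on $n$ elements and $v\in P$, a linear extension is an order-preserving bijection $\phi:P\to[n]$, and $h_k(P,v)$ is the number of linear extensions $\phi$ with $\phi(v)=k+1$. -}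

module Defs where

open import Data.Nat using (ℕ; zero; suc; _≤_; _<_; _≤?_; _<?_)
open import Data.Nat.Properties using (_≟_; <-trans)
open import Data.Fin using (Fin; toℕ; fromℕ<)
open import Data.Fin.Properties using (toℕ-fromℕ<)
import Data.Fin.Properties as FinP
open import Data.Product using (_×_; _,_; Σ; proj₁; proj₂)
open import Data.Product.Properties using (≡-dec)
open import Data.Sum using (_⊎_; inj₁; inj₂)
open import Data.List using (List; []; _∷_; length; filter; concatMap; map; upTo)
open import Data.List.Relation.Unary.All using (All; all?)
open import Data.List.Relation.Unary.Unique.Propositional using (Unique)
open import Data.List.Relation.Unary.Unique.DecPropositional _≟_ using (unique?)
open import Relation.Binary.Definitions using (DecidableEquality)
open import Relation.Binary.PropositionalEquality using (_≡_; refl; subst)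
open import Relation.Binary.Construct.Closure.Transitive using (TransClosure; [_]; _∷_)
open import Relation.Nullary using (Dec; yes; no; ¬_)
open import Relation.Nullary.Decidable using (_×-dec_; _⊎-dec_; ¬?; map′; _→-dec_)

-- Positions and values are the positive integers 1,2,...
-- A sequence h : ℕ → ℕ is only ever evaluated at positive arguments.
-- Sets of pairs of positive integers are finite lists of pairs, compared
-- as sets (by membership).

_≟₂_ : DecidableEquality (ℕ × ℕ)
_≟₂_ = ≡-dec _≟_ _≟_

open import Data.List.Membership.DecPropositional _≟₂_ public
  using (_∈_; _∉_; _∈?_)

[1…_] : ℕ → List ℕ
[1… n ] = map suc (upTo n)

words : ℕ → ℕ → List (List ℕ)
words k zero    = [] ∷ []
words k (suc n) = concatMap (λ x → map (x ∷_) (words k n)) [1… k ]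

-- 1-based lookup: at π i = π_i  (junk value 0 outside 1..length π)
at : List ℕ → ℕ → ℕ
at []       _             = 0
at (x ∷ xs) zero          = 0
at (x ∷ xs) (suc zero)    = x
at (x ∷ xs) (suc (suc i)) = at xs (suc i)

-- π ∈ S_n, written in one-line notation π = π_1 π_2 ... π_n
IsPerm : ℕ → List ℕ → Set
IsPerm n π = (length π ≡ n) × All (λ x → 1 ≤ x × x ≤ n) π × Unique π

isPerm? : (n : ℕ) (π : List ℕ) → Dec (IsPerm n π)
isPerm? n π = (length π ≟ n) ×-dec all? (λ x → (1 ≤? x) ×-dec (x ≤? n)) π ×-dec unique? π

perms : ℕ → List (List ℕ)
perms n = filter (isPerm? n) (words n n)

InP : (ℕ → ℕ) → ℕ → ℕ → Set
InP h i j = 1 ≤ i × i < j × j ≤ h i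

InP? : (h : ℕ → ℕ) (i j : ℕ) → Dec (InP h i j)
InP? h i j = (1 ≤? i) ×-dec (i <? j) ×-dec (j ≤? h i)

InInv : (ℕ → ℕ) → ℕ → List ℕ → ℕ × ℕ → Set
InInv h n π (i , j) = InP h i j × j ≤ n × at π j < at π i

InInv? : (h : ℕ → ℕ) (n : ℕ) (π : List ℕ) (p : ℕ × ℕ) → Dec (InInv h n π p)
InInv? h n π (i , j) = InP? h i j ×-dec (j ≤? n) ×-dec (at π j <? at π i)

pairsUpTo : ℕ → List (ℕ × ℕ)
pairsUpTo n = concatMap (λ i → map (i ,_) [1… n ]) [1… n ]

-- inv_h(π) as a finite set (every element of inv_h(π) has 1 ≤ i < j ≤ n)
inv : (ℕ → ℕ) → ℕ → List ℕ → List (ℕ × ℕ)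
inv h n π = filter (InInv? h n π) (pairsUpTo n)

SameSet : List (ℕ × ℕ) → List (ℕ × ℕ) → Set
SameSet A B = All (_∈ B) A × All (_∈ A) B

SameSet? : (A B : List (ℕ × ℕ)) → Dec (SameSet A B)
SameSet? A B = all? (_∈? B) A ×-dec all? (_∈? A) B

Admissible : (ℕ → ℕ) → List (ℕ × ℕ) → Set
Admissible h S = Σ ℕ λ N → Σ (List ℕ) λ σ → IsPerm N σ × SameSet (inv h N σ) S

I : (ℕ → ℕ) → List (ℕ × ℕ) → ℕ → List (List ℕ)
I h S n = filter (λ π → SameSet? (inv h n π) S) (perms n)

-- b_k(S) = #{π ∈ I_h(S, h(m)) : π_{h(m)} = k}, where m = m(S)
b : (ℕ → ℕ) → List (ℕ × ℕ) → (m k : ℕ) → ℕ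
b h S m k = length (filter (λ π → at π (h m) ≟ k) (I h S (h m)))

-- The poset P_{h,S} on [h(m)].
-- Generating relations:  j <_S i  when (i,j) ∈ S,
--                        i <_S j  when (i,j) ∈ P_h ∖ S, j ≤ h(m).

Gen : (ℕ → ℕ) → List (ℕ × ℕ) → ℕ → ℕ → ℕ → Set
Gen h S m x y =
  (1 ≤ x × x ≤ h m) × (1 ≤ y × y ≤ h m) ×
  ((y , x) ∈ S ⊎ (InP h x y × (x , y) ∉ S × y ≤ h m))

Gen? : (h : ℕ → ℕ) (S : List (ℕ × ℕ)) (m x y : ℕ) → Dec (Gen h S m x y)
Gen? h S m x y =
  ((1 ≤? x) ×-dec (x ≤? h m)) ×-dec ((1 ≤? y) ×-dec (y ≤? h m)) ×-dec
  (((y , x) ∈? S) ⊎-dec (InP? h x y ×-dec ¬? ((x , y) ∈? S) ×-dec (y ≤? h m)))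

_<[_,_,_]_ : ℕ → (ℕ → ℕ) → List (ℕ × ℕ) → ℕ → ℕ → Set
x <[ h , S , m ] y = TransClosure (Gen h S m) x y

LinExt : (ℕ → ℕ) → List (ℕ × ℕ) → ℕ → List ℕ → Set
LinExt h S m φ =
  IsPerm (h m) φ × (∀ x y → x <[ h , S , m ] y → at φ x < at φ y)

private
  module _ (h : ℕ → ℕ) (S : List (ℕ × ℕ)) (m : ℕ) (φ : List ℕ) where
    N = h m

    GenPres : Set
    GenPres = (x y : Fin (suc N)) →
      Gen h S m (toℕ x) (toℕ y) → at φ (toℕ x) < at φ (toℕ y)

    genPres? : Dec GenPres
    genPres? = FinP.all? λ x → FinP.all? λ y →
      Gen? h S m (toℕ x) (toℕ y) →-dec (at φ (toℕ x) <? at φ (toℕ y))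

    pres→gen : (∀ x y → x <[ h , S , m ] y → at φ x < at φ y) → GenPres
    pres→gen f x y g = f (toℕ x) (toℕ y) [ g ]

    gen1 : GenPres → ∀ x y → Gen h S m x y → at φ x < at φ y
    gen1 f x y g =
      subst (λ u → at φ u < at φ y) (toℕ-fromℕ< x<)
        (subst (λ v → at φ (toℕ (fromℕ< x<)) < at φ v) (toℕ-fromℕ< y<)
          (f (fromℕ< x<) (fromℕ< y<)
            (subst (λ u → Gen h S m u (toℕ (fromℕ< y<))) (Relation.Binary.PropositionalEquality.sym (toℕ-fromℕ< x<))
              (subst (λ v → Gen h S m x v) (Relation.Binary.PropositionalEquality.sym (toℕ-fromℕ< y<)) g))))
      where
        open import Data.Nat using (s≤s)
        x< : x < suc N
        x< = s≤s (proj₂ (proj₁ g))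
        y< : y < suc N
        y< = s≤s (proj₂ (proj₁ (proj₂ g)))

    gen→pres : GenPres → ∀ x y → x <[ h , S , m ] y → at φ x < at φ y
    gen→pres f x y [ g ]        = gen1 f x y g
    gen→pres f x y (g ∷ rest)   = <-trans (gen1 f x _ g) (gen→pres f _ y rest)

LinExt? : (h : ℕ → ℕ) (S : List (ℕ × ℕ)) (m : ℕ) (φ : List ℕ) → Dec (LinExt h S m φ)
LinExt? h S m φ = isPerm? (h m) φ ×-dec
  map′ (gen→pres h S m φ) (pres→gen h S m φ) (genPres? h S m φ)

linExts : (ℕ → ℕ) → List (ℕ × ℕ) → ℕ → List (List ℕ)
linExts h S m = filter (LinExt? h S m) (words (h m) (h m))

hk : (ℕ → ℕ) → List (ℕ × ℕ) → (m k v : ℕ) → ℕ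
hk h S m k v = length (filter (λ φ → at φ v ≟ suc k) (linExts h S m))

-- For π ∈ S_{h(m)}, the condition inv_h(π) = S says, pair by pair of P_h, which of π_i, π_j is
-- larger; these are exactly the generating relations of P_{h,S}, so I_h(S, h(m)) is the set of
-- linear extensions of P_{h,S} (in one-line notation) and b_k(S) = h_{k-1}(P_{h,S}, h(m)).
-- The one point needing the hypotheses on h and m is that every (i, j) ∈ S has j ≤ h(m):
-- if S = inv_h(σ) and σ_j < σ_i, then σ has a descent (l, l+1) with i ≤ l < j; it lies in P_h
-- because l < h(l), hence in S, so l ≤ m and j ≤ h(i) ≤ h(m).
module Submission where

open import Defs
open import Data.Nat using (ℕ; suc; zero; _≤_; _<_; _∸_; s≤s; z≤n; _<?_)
open import Data.Nat.Properties
  using (_≟_; ≤-refl; ≤-trans; <-trans; ≤-<-trans; <-≤-trans; <⇒≤; <⇒≢; <⇒≱; <-asym; ≮⇒≥;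
         ≤∧≢⇒<; n<1+n; m<n⇒m<1+n; m<1+n⇒m<n∨m≡n; m<n⇒0<n∸m)
open import Data.Product using (_×_; _,_; proj₁; proj₂; uncurry; ∃-syntax)
open import Data.Sum using (inj₁; inj₂)
open import Data.List using (List; []; _∷_; filter; length; map)
open import Data.List.Properties using (filter-≐)
open import Data.List.Relation.Unary.All as All using (All; _∷_)
open import Data.List.Relation.Unary.Any as Any using ()
open import Data.List.Relation.Unary.AllPairs using (_∷_)
open import Data.List.Relation.Unary.Unique.Propositional using (Unique)
open import Data.List.Membership.Propositional.Properties
  using (∈-filter⁺; ∈-filter⁻; ∈-concatMap⁺; ∈-map⁺; ∈-upTo⁺)
open import Function using (_∘_)
open import Relation.Binary.PropositionalEquality using (_≡_; _≢_; refl; sym; trans; cong)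
open import Relation.Binary.Construct.Closure.Transitive using (TransClosure; [_]; _∷_)
open import Relation.Nullary using (yes; no; contradiction)
open import Relation.Unary using (Decidable)
open import Relation.Unary.Properties using (_∩?_)

filter-filter : ∀ {A : Set} {P Q : A → Set} (P? : Decidable P) (Q? : Decidable Q) xs →
                filter P? (filter Q? xs) ≡ filter (Q? ∩? P?) xs
filter-filter P? Q? [] = refl
filter-filter P? Q? (x ∷ xs) with Q? x
... | no  _ = filter-filter P? Q? xs
... | yes _ with P? x
...   | yes _ = cong (x ∷_) (filter-filter P? Q? xs)
...   | no  _ = filter-filter P? Q? xs

All-at : ∀ {P : ℕ → Set} {xs i} → All P xs → i < length xs → P (at xs (suc i))
All-at {xs = x ∷ xs} {zero}  (px ∷ _)   _         = px
All-at {xs = x ∷ xs} {suc i} (_  ∷ pxs) (s≤s i<n) = All-at pxs i<n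

at-injective : ∀ {n π a c} → IsPerm n π → 1 ≤ a × a ≤ n → 1 ≤ c × c ≤ n →
               at π a ≡ at π c → a ≡ c
at-injective (refl , _ , uniq) (s≤s z≤n , a≤n) (s≤s z≤n , c≤n) = cong suc ∘ go uniq a≤n c≤n
  where
    go : ∀ {xs a c} → Unique xs → a < length xs → c < length xs →
         at xs (suc a) ≡ at xs (suc c) → a ≡ c
    go {a = zero}  {zero}  _           _         _         _  = refl
    go {a = zero}  {suc c} (x∉xs ∷ _)  _         (s≤s c<n) eq = contradiction eq (All-at x∉xs c<n)
    go {a = suc a} {zero}  (x∉xs ∷ _)  (s≤s a<n) _         eq = contradiction (sym eq) (All-at x∉xs a<n)
    go {a = suc a} {suc c} (_ ∷ uniq)  (s≤s a<n) (s≤s c<n) eq = cong suc (go uniq a<n c<n eq)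

ends-in-range : ∀ {i j n} → 1 ≤ i → i < j → j ≤ n → (1 ≤ i × i ≤ n) × (1 ≤ j × j ≤ n)
ends-in-range 1≤i i<j j≤n = (1≤i , <⇒≤ (<-≤-trans i<j j≤n)) , (≤-trans 1≤i (<⇒≤ i<j) , j≤n)

∈-pairsUpTo : ∀ {i j n} → 1 ≤ i × i ≤ n → 1 ≤ j × j ≤ n → (i , j) ∈ pairsUpTo n
∈-pairsUpTo {suc i} {suc j} {n} (_ , i≤n) (_ , j≤n) =
  ∈-concatMap⁺ (λ u → map (u ,_) [1… n ])
    (Any.map (λ { refl → ∈-map⁺ (suc i ,_) (∈-map⁺ suc (∈-upTo⁺ j≤n)) })
             (∈-map⁺ suc (∈-upTo⁺ i≤n)))

module _ (h : ℕ → ℕ) (n : ℕ) (π : List ℕ) where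

  ∈-inv⁺ : ∀ {i j} → InInv h n π (i , j) → (i , j) ∈ inv h n π
  ∈-inv⁺ ij@((1≤i , i<j , _) , j≤n , _) =
    ∈-filter⁺ (InInv? h n π) (uncurry ∈-pairsUpTo (ends-in-range 1≤i i<j j≤n)) ij

  ∈-inv⁻ : ∀ {i j} → (i , j) ∈ inv h n π → InInv h n π (i , j)
  ∈-inv⁻ = proj₂ ∘ ∈-filter⁻ (InInv? h n π) {xs = pairsUpTo n}

descent : (f : ℕ → ℕ) {i j : ℕ} → i < j → f j < f i → ∃[ l ] i ≤ l × l < j × f (suc l) < f l
descent f {i} {suc j} i<1+j fj<fi with m<1+n⇒m<n∨m≡n i<1+j
... | inj₂ refl = i , ≤-refl , n<1+n i , fj<fi
... | inj₁ i<j with f (suc j) <? f j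
...   | yes f1+j<fj = j , <⇒≤ i<j , n<1+n j , f1+j<fj
...   | no  f1+j≮fj with descent f i<j (≤-<-trans (≮⇒≥ f1+j≮fj) fj<fi)
...     | l , i≤l , l<j , fl+1<fl = l , i≤l , m<n⇒m<1+n l<j , fl+1<fl

TransClosure-preserves-< : ∀ {R : ℕ → ℕ → Set} (f : ℕ → ℕ) → (∀ {x y} → R x y → f x < f y) →
                           ∀ {x y} → TransClosure R x y → f x < f y
TransClosure-preserves-< f pres [ xRy ]      = pres xRy
TransClosure-preserves-< f pres (xRy ∷ yR⁺z) = <-trans (pres xRy) (TransClosure-preserves-< f pres yR⁺z)

WithinP : (ℕ → ℕ) → List (ℕ × ℕ) → ℕ → Set
WithinP h S m = ∀ {i j} → (i , j) ∈ S → InP h i j × j ≤ h m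

admissible-withinP : ∀ {h : ℕ → ℕ} → (∀ i j → 1 ≤ i → i ≤ j → h i ≤ h j) → (∀ i → 1 ≤ i → i < h i) →
                     ∀ {S} → Admissible h S → ∀ {m} → (∀ i → (i , suc i) ∈ S → i ≤ m) → WithinP h S m
admissible-withinP {h} mono expanding (N , σ , _ , inv⊆S , S⊆inv) {m} maximal {i} ij∈S
  with ∈-inv⁻ h N σ (All.lookup S⊆inv ij∈S)
... | ij∈Ph@(1≤i , i<j , j≤hi) , j≤N , σj<σi
  with descent (at σ) i<j σj<σi
... | l , i≤l , l<j , σl+1<σl = ij∈Ph , ≤-trans j≤hi (mono i m 1≤i (≤-trans i≤l l≤m))
  where
    1≤l : 1 ≤ l
    1≤l = ≤-trans 1≤i i≤l
    l≤m : l ≤ m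
    l≤m = maximal l (All.lookup inv⊆S
            (∈-inv⁺ h N σ ((1≤l , n<1+n l , expanding l 1≤l) , ≤-trans l<j j≤N , σl+1<σl)))

module _ (h : ℕ → ℕ) (S : List (ℕ × ℕ)) (m : ℕ) where

  OrderPreserving : List ℕ → Set
  OrderPreserving φ = ∀ x y → x <[ h , S , m ] y → at φ x < at φ y

  sameSet⇒orderPreserving : ∀ {π} → IsPerm (h m) π → SameSet (inv h (h m) π) S → OrderPreserving π
  sameSet⇒orderPreserving {π} perm (inv⊆S , S⊆inv) _ _ = TransClosure-preserves-< (at π) gen
    where
      gen : ∀ {x y} → Gen h S m x y → at π x < at π y
      gen (_ , _ , inj₁ yx∈S) = proj₂ (proj₂ (∈-inv⁻ h (h m) π (All.lookup S⊆inv yx∈S)))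
      gen {x} {y} (x∈ , y∈ , inj₂ (xy∈Ph , xy∉S , y≤n)) with at π y <? at π x
      ... | yes πy<πx = contradiction (All.lookup inv⊆S (∈-inv⁺ h (h m) π (xy∈Ph , y≤n , πy<πx))) xy∉S
      ... | no  πy≮πx = ≤∧≢⇒< (≮⇒≥ πy≮πx) (<⇒≢ (proj₁ (proj₂ xy∈Ph)) ∘ at-injective perm x∈ y∈)

  orderPreserving⇒sameSet : WithinP h S m →
                            ∀ {π} → OrderPreserving π → SameSet (inv h (h m) π) S
  orderPreserving⇒sameSet withinP {π} pres = All.tabulate inv⊆S , All.tabulate S⊆inv
    where
      inv⊆S : ∀ {p} → p ∈ inv h (h m) π → p ∈ S
      inv⊆S {i , j} ij∈inv with ∈-inv⁻ h (h m) π ij∈inv | (i , j) ∈? S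
      ... | _                                        | yes ij∈S = ij∈S
      ... | ij∈Ph@(1≤i , i<j , _) , j≤n , πj<πi | no  ij∉S with ends-in-range 1≤i i<j j≤n
      ...   | i∈ , j∈ = contradiction (pres i j [ i∈ , j∈ , inj₂ (ij∈Ph , ij∉S , j≤n) ]) (<-asym πj<πi)
      S⊆inv : ∀ {p} → p ∈ S → p ∈ inv h (h m) π
      S⊆inv {i , j} ij∈S with withinP ij∈S
      ... | ij∈Ph@(1≤i , i<j , _) , j≤n with ends-in-range 1≤i i<j j≤n
      ...   | i∈ , j∈ = ∈-inv⁺ h (h m) π (ij∈Ph , j≤n , pres j i [ j∈ , i∈ , inj₁ ij∈S ])

  I≡linExts : WithinP h S m → I h S (h m) ≡ linExts h S m
  I≡linExts withinP =
    trans (filter-filter (λ π → SameSet? (inv h (h m) π) S) (isPerm? (h m)) (words (h m) (h m)))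
          (filter-≐ _ (LinExt? h S m) (to , from) (words (h m) (h m)))
    where
      to : ∀ {π} → IsPerm (h m) π × SameSet (inv h (h m) π) S → LinExt h S m π
      to (perm , same) = perm , sameSet⇒orderPreserving perm same
      from : ∀ {π} → LinExt h S m π → IsPerm (h m) π × SameSet (inv h (h m) π) S
      from {π} (perm , pres) = perm , orderPreserving⇒sameSet withinP {π} pres

lemma4p6 : (h : ℕ → ℕ)
    → (∀ i j → 1 ≤ i → i ≤ j → h i ≤ h j)
    → (∀ i → 1 ≤ i → i < h i)
    → (S : List (ℕ × ℕ))
    → S ≢ []
    → Admissible h S
    → (m : ℕ)
    → (m , suc m) ∈ S
    → (∀ i → (i , suc i) ∈ S → i ≤ m)
    → (k : ℕ)
    → h m ∸ m ≤ k
    → k ≤ h m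
    → b h S m k ≡ hk h S m (k ∸ 1) (h m)
-- k ∸ 1 is truncated, so k = 0 must be excluded; the lower bound on k does so because m < h(m).
lemma4p6 h mono expanding S _ adm m m,m+1∈S maximal zero hm∸m≤0 _ =
  contradiction hm∸m≤0 (<⇒≱ (m<n⇒0<n∸m (expanding m 1≤m)))
  where
    1≤m : 1 ≤ m
    1≤m = proj₁ (proj₁ (admissible-withinP mono expanding adm maximal m,m+1∈S))
lemma4p6 h mono expanding S _ adm m _ maximal (suc k) _ _ =
  cong (length ∘ filter (λ π → at π (h m) ≟ suc k))
       (I≡linExts h S m (admissible-withinP mono expanding adm maximal))
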